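{- Let $d\geq2$ be an integer with $p\nmid d$ and let $a(z)=z+\sum_{n=1}^{+\infty}F_{n}z^{d^{n}}$, where $F_{n}$ is the residue modulo $d$ of the $n$-th Fibonacci number ($F_{1}=F_{2}=1$). Then the functions $1,\ a(z),\ a(z^{d})$ are linearly independent over $\overline{\mathbb{K}}(z)$.
   Context: Let $p$ be a prime, $q=p^{r}$, $K=\mathbb{F}_{q}(T)$, $\mathbb{K}$ a finite extension of $K$ and $\overline{\mathbb{K}}$ an algebraic closure of $\mathbb{K}$. The residues $F_n\in\{0,\ldots,d-1\}$ are viewed as elements of the prime field $\mathbb{F}_p$, and $a(z)$ as a formal power series. -}

module Defs where

open import Level using (Level; _⊔_)
open import Algebra.Bundles using (CommutativeRing)
open import Data.Nat as ℕ using (ℕ; zero; suc; _∸_; _%_; _≟_)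
open import Data.Fin using (Fin; toℕ)
open import Data.List using (List; []; _∷_; _++_; [_]; length; lookup)
open import Data.List.Relation.Unary.Any using (Any)
open import Data.Product using (Σ; ∃; _×_; _,_)
open import Data.Sum using (_⊎_)
open import Relation.Nullary using (¬_; yes; no)
import Relation.Binary.PropositionalEquality

fib : ℕ → ℕ
fib zero = 0
fib (suc zero) = 1
fib (suc (suc n)) = fib (suc n) ℕ.+ fib n

-- Weights of the lacunary series a(z) = Σ_{n ≥ 0} w n · z^(d^n):
-- w 0 = 1 (the term z = z^(d^0)), and w n = F_n mod d for n ≥ 1.
aWeight : ℕ → ℕ → ℕ
aWeight d zero = 1
aWeight d (suc n) with d
... | zero = 0
... | suc d' = fib (suc n) % suc d'

module _ {c ℓ : Level} (R : CommutativeRing c ℓ) where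
  open CommutativeRing R

  ι : ℕ → Carrier
  ι zero = 0#
  ι (suc n) = 1# + ι n

  Σ< : ℕ → (ℕ → Carrier) → Carrier
  Σ< zero f = 0#
  Σ< (suc n) f = Σ< n f + f n

  _^_ : Carrier → ℕ → Carrier
  x ^ zero = 1#
  x ^ suc n = x * (x ^ n)

  IsField : Set (c ⊔ ℓ)
  IsField = (¬ (1# ≈ 0#)) × (∀ x → ¬ (x ≈ 0#) → ∃ λ y → (x * y) ≈ 1#)

  -- characteristic p (p prime is assumed separately)
  HasChar : ℕ → Set ℓ
  HasChar p = ι p ≈ 0#

  -- polynomials over R as coefficient lists (constant term first)
  evalPoly : List Carrier → Carrier → Carrier
  evalPoly [] x = 0#
  evalPoly (a ∷ as) x = a + x * evalPoly as x

  -- every monic polynomial of degree ≥ 1 has a root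
  AlgClosed : Set (c ⊔ ℓ)
  AlgClosed = ∀ (a : Carrier) (as : List Carrier) →
              ∃ λ x → evalPoly (a ∷ as ++ [ 1# ]) x ≈ 0#

  -- polynomials with coefficients in the prime field F_p = Fin p
  evalFp : {p : ℕ} → List (Fin p) → Carrier → Carrier
  evalFp [] x = 0#
  evalFp (a ∷ as) x = ι (toℕ a) + x * evalFp as x

  -- bivariate polynomial over F_p: Σ_i P_i(T) X^i
  evalFp2 : {p : ℕ} → List (List (Fin p)) → Carrier → Carrier → Carrier
  evalFp2 [] t x = 0#
  evalFp2 (a ∷ as) t x = evalFp a t + x * evalFp2 as t x

  Transcendental : (p : ℕ) → Carrier → Set ℓ
  Transcendental p t = ∀ (P : List (Fin p)) →
    Any (λ a → ¬ (toℕ a ≡ℕ 0)) P → ¬ (evalFp P t ≈ 0#)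
    where
      _≡ℕ_ : ℕ → ℕ → Set
      m ≡ℕ n = m Relation.Binary.PropositionalEquality.≡ n

  -- x is algebraic over F_p(t): a nonzero Q(t, X) ∈ F_p[t][X] kills x
  -- (nonzero as a polynomial in X, i.e. some Q_i(t) ≠ 0 in R)
  AlgebraicOver : (p : ℕ) → Carrier → Carrier → Set ℓ
  AlgebraicOver p t x = ∃ λ (Q : List (List (Fin p))) →
    Any (λ q → ¬ (evalFp q t ≈ 0#)) Q × (evalFp2 Q t x ≈ 0#)

  coeff : List Carrier → ℕ → Carrier
  coeff [] k = 0#
  coeff (a ∷ as) zero = a
  coeff (a ∷ as) (suc k) = coeff as k

  NonZeroPoly : List Carrier → Set (c ⊔ ℓ)
  NonZeroPoly P = Any (λ a → ¬ (a ≈ 0#)) P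

  -- coefficient of z^m in the power series a(z^(d^s)) = Σ_n w n z^(d^(n+s)),
  -- with coefficients mapped F_p → R (i.e. natural residues via ι)
  lacCoeff : (d s : ℕ) → ℕ → Carrier
  lacCoeff d s m = Σ< (suc m) λ n → indic (d ℕ.^ (n ℕ.+ s)) n
    where
      indic : ℕ → ℕ → Carrier
      indic e n with e ≟ m
      ... | yes _ = ι (aWeight d n)
      ... | no _  = 0#

  mulCoeff : List Carrier → (ℕ → Carrier) → ℕ → Carrier
  mulCoeff P f m = Σ< (suc m) λ k → coeff P k * f (m ∸ k)

  -- 1, a(z), a(z^d) are linearly dependent over R(z): after clearing
  -- denominators, there are P0, P1, P2 ∈ R[z], not all zero, with
  -- P0 + P1 a(z) + P2 a(z^d) = 0 as a formal power series.
  LinDep-1-a-ad : ℕ → Set (c ⊔ ℓ)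
  LinDep-1-a-ad d = Σ (List Carrier) λ P0 → Σ (List Carrier) λ P1 → Σ (List Carrier) λ P2 →
    (NonZeroPoly P0 ⊎ NonZeroPoly P1 ⊎ NonZeroPoly P2) ×
    (∀ m → (coeff P0 m + mulCoeff P1 (lacCoeff d 0) m + mulCoeff P2 (lacCoeff d 1) m) ≈ 0#)

-- Suppose P₀ + P₁ a(z) + P₂ a(z^d) = 0 with a(z) = Σ w n z^(d^n) and all
-- Pᵢ of degree < d^M. Near the exponent d^(M+1) the only terms of a(z) and a(z^d) are
-- w (M+1) z^(d^(M+1)) and w M z^(d^(M+1)), so the coefficient of z^(d^(M+1) + k), k < d^M,
-- gives w (M+1) P₁[k] + w M P₂[k] = 0. The Fibonacci sequence mod d is purely periodic,
-- since its step (x, y) ↦ (y, x + y) is invertible mod d; at a large multiple K of a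
-- period (w K, w (K+1), w (K+2)) = (0, 1, 1), and M = K, K + 1 give P₁ = P₂ = 0, then P₀ = 0.
module Submission where

open import Level using (Level)
open import Defs
  using (fib; aWeight; Σ<; ι; coeff; mulCoeff; lacCoeff; NonZeroPoly; LinDep-1-a-ad;
         IsField; HasChar; AlgClosed; Transcendental; AlgebraicOver)
open import Algebra.Bundles using (CommutativeRing)
open import Data.Nat
  using (ℕ; zero; suc; _+_; _*_; _^_; _∸_; _%_; _<_; _≤_; _≟_; NonZero; z≤n; s≤s)
open import Data.Nat.Properties
open import Data.Nat.DivMod using (_mod_; %-distribˡ-+; %-distribˡ-*; [m+kn]%n≡m%n)
open import Data.Nat.Divisibility using (_∣_)
open import Data.Nat.Primality using (Prime)
open import Data.Nat.Solver using (module +-*-Solver)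
open import Data.Fin using (Fin; toℕ; combine)
open import Data.Fin.Properties using (pigeonhole; combine-injective; toℕ-fromℕ<)
open import Data.List using (List; []; _∷_; length)
open import Data.List.Relation.Unary.Any using (here; there)
open import Data.Product using (∃; ∃₂; _×_; _,_; proj₁; proj₂; uncurry)
open import Data.Product.Properties using (,-injective)
open import Data.Sum using (_⊎_; [_,_])
open import Function using (_∘_)
open import Relation.Binary using (tri<; tri≈; tri>)
open import Relation.Binary.PropositionalEquality
  using (_≡_; _≢_; refl; sym; trans; cong; cong₂; subst; module ≡-Reasoning)
open import Relation.Nullary using (¬_; yes; no; contradiction)

n<m^n : ∀ {m} → 1 < m → ∀ n → n < m ^ n
n<m^n {m} 1<m zero = s≤s z≤n
n<m^n {m@(suc _)} 1<m (suc n) = ≤-<-trans (n<m^n 1<m n) m^n<m^1+n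
  where
  instance _ = m^n≢0 m n
  m^n<m^1+n : m ^ n < m * m ^ n
  m^n<m^1+n = subst (_< m * m ^ n) (*-identityˡ (m ^ n)) (*-monoˡ-< (m ^ n) 1<m)

^-injectiveʳ : ∀ {m} → 1 < m → ∀ {i j} → m ^ i ≡ m ^ j → i ≡ j
^-injectiveʳ {m} 1<m {i} {j} eq with <-cmp i j
... | tri< i<j _ _ = contradiction eq (<⇒≢ (^-monoʳ-< m 1<m i<j))
... | tri≈ _ i≡j _ = i≡j
... | tri> _ _ i>j = contradiction (sym eq) (<⇒≢ (^-monoʳ-< m 1<m i>j))

m^n+m^n≤m^1+n : ∀ {m} → 2 ≤ m → ∀ n → m ^ n + m ^ n ≤ m ^ suc n
m^n+m^n≤m^1+n {m} 2≤m n =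
  subst (_≤ m ^ suc n) (cong (m ^ n +_) (+-identityʳ (m ^ n))) (*-monoˡ-≤ (m ^ n) 2≤m)

pow-gap : ∀ {m} → 2 ≤ m → ∀ {e n j k} → j < m ^ n → k < m ^ n →
          m ^ e + j ≡ m ^ suc n + k → j ≡ k
pow-gap {m@(suc _)} 2≤m {e} {n} {j} {k} j<m^n k<m^n eq with <-cmp e (suc n)
... | tri< e<1+n _ _ = contradiction eq (<⇒≢ (begin-strict
  m ^ e + j          <⟨ +-mono-≤-< (^-monoʳ-≤ m (≤-pred e<1+n)) j<m^n ⟩
  m ^ n + m ^ n      ≤⟨ m^n+m^n≤m^1+n 2≤m n ⟩
  m ^ suc n          ≤⟨ m≤m+n (m ^ suc n) k ⟩
  m ^ suc n + k      ∎))
  where open ≤-Reasoning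
... | tri≈ _ refl _ = +-cancelˡ-≡ (m ^ e) j k eq
... | tri> _ _ e>1+n = contradiction (sym eq) (<⇒≢ (begin-strict
  m ^ suc n + k          <⟨ +-monoʳ-< (m ^ suc n) (<-≤-trans k<m^n (^-monoʳ-≤ m (n≤1+n n))) ⟩
  m ^ suc n + m ^ suc n  ≤⟨ m^n+m^n≤m^1+n 2≤m (suc n) ⟩
  m ^ suc (suc n)        ≤⟨ ^-monoʳ-≤ m e>1+n ⟩
  m ^ e                  ≤⟨ m≤m+n (m ^ e) j ⟩
  m ^ e + j              ∎))
  where open ≤-Reasoning

module _ {d : ℕ} .{{_ : NonZero d}} where

  %-cong-+ : ∀ {a a′ b b′} → a % d ≡ a′ % d → b % d ≡ b′ % d → (a + b) % d ≡ (a′ + b′) % d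
  %-cong-+ {a} {a′} {b} {b′} a≡a′ b≡b′ = begin
    (a + b) % d              ≡⟨ %-distribˡ-+ a b d ⟩
    (a % d + b % d) % d      ≡⟨ cong₂ (λ x y → (x + y) % d) a≡a′ b≡b′ ⟩
    (a′ % d + b′ % d) % d    ≡⟨ %-distribˡ-+ a′ b′ d ⟨
    (a′ + b′) % d            ∎
    where open ≡-Reasoning

  %-cong-*ˡ : ∀ c {b b′} → b % d ≡ b′ % d → (c * b) % d ≡ (c * b′) % d
  %-cong-*ˡ c {b} {b′} b≡b′ = begin
    (c * b) % d              ≡⟨ %-distribˡ-* c b d ⟩
    (c % d * (b % d)) % d    ≡⟨ cong (λ x → (c % d * x) % d) b≡b′ ⟩
    (c % d * (b′ % d)) % d   ≡⟨ %-distribˡ-* c b′ d ⟨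
    (c * b′) % d             ∎
    where open ≡-Reasoning

  mod≡⇒%≡ : ∀ a b → a mod d ≡ b mod d → a % d ≡ b % d
  mod≡⇒%≡ a b a≡b = trans (sym (toℕ-fromℕ< _)) (trans (cong toℕ a≡b) (toℕ-fromℕ< _))

sequence-repeats : ∀ {m n} (s : ℕ → Fin m × Fin n) → ∃₂ λ i j → i < j × s i ≡ s j
sequence-repeats {m} {n} s with pigeonhole (n<1+n (m * n)) (uncurry combine ∘ s ∘ toℕ)
... | i , j , i<j , eq = toℕ i , toℕ j , i<j , combine-injective′ eq
  where
  combine-injective′ : ∀ {x y : Fin m × Fin n} → uncurry combine x ≡ uncurry combine y → x ≡ y
  combine-injective′ {x₁ , x₂} {y₁ , y₂} eq = uncurry (cong₂ _,_) (combine-injective x₁ x₂ y₁ y₂ eq)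

module _ {a} {A : Set a} (s : ℕ → A) where

  Deterministic : Set a
  Deterministic = ∀ m n → s m ≡ s n → s (suc m) ≡ s (suc n)

  Reversible : Set a
  Reversible = ∀ m n → s (suc m) ≡ s (suc n) → s m ≡ s n

  deterministic-+ˡ : Deterministic → ∀ {m n} k → s m ≡ s n → s (k + m) ≡ s (k + n)
  deterministic-+ˡ det zero    eq = eq
  deterministic-+ˡ det {m} {n} (suc k) eq = det (k + m) (k + n) (deterministic-+ˡ det k eq)

  reversible-+ˡ : Reversible → ∀ {m n} k → s (k + m) ≡ s (k + n) → s m ≡ s n
  reversible-+ˡ rev zero    eq = eq
  reversible-+ˡ rev {m} {n} (suc k) eq = reversible-+ˡ rev k (rev (k + m) (k + n) eq)

  reversible-repeat⇒return : Reversible → ∀ {i j} → i < j → s i ≡ s j → ∃ λ q → s 0 ≡ s (suc q)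
  reversible-repeat⇒return rev {i} i<j eq with m≤n⇒∃[o]m+o≡n i<j
  ... | q , refl = q , reversible-+ˡ rev i (begin
    s (i + 0)      ≡⟨ cong s (+-identityʳ i) ⟩
    s i            ≡⟨ eq ⟩
    s (suc i + q)  ≡⟨ cong s (+-suc i q) ⟨
    s (i + suc q)  ∎)
    where open ≡-Reasoning

  deterministic-return⇒periodic : Deterministic → ∀ {p} → s 0 ≡ s p → ∀ t n → s (n + t * p) ≡ s n
  deterministic-return⇒periodic det {p} ret zero    n = cong s (+-identityʳ n)
  deterministic-return⇒periodic det {p} ret (suc t) n = begin
    s (n + (p + t * p))  ≡⟨ cong s (+-assoc n p (t * p)) ⟨
    s (n + p + t * p)    ≡⟨ deterministic-return⇒periodic det ret t (n + p) ⟩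
    s (n + p)            ≡⟨ deterministic-+ˡ det n ret ⟨
    s (n + 0)            ≡⟨ cong s (+-identityʳ n) ⟩
    s n                  ∎
    where open ≡-Reasoning

module FibonacciMod (d-1 : ℕ) where

  private
    d : ℕ
    d = suc d-1

  -- F n = F (n + 2) − F (n + 1), with the subtraction done as adding (d − 1) F (n + 1).
  fib-%-backward : ∀ n → fib n % d ≡ (fib (2 + n) + d-1 * fib (1 + n)) % d
  fib-%-backward n = begin
    fib n % d                                ≡⟨ [m+kn]%n≡m%n (fib n) (fib (1 + n)) d ⟨
    (fib n + fib (1 + n) * d) % d            ≡⟨ cong (_% d) (solve 3 (λ x y e →
                                                  x :+ y :* (con 1 :+ e) := (y :+ x) :+ e :* y)
                                                  refl (fib n) (fib (1 + n)) d-1) ⟩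
    (fib (2 + n) + d-1 * fib (1 + n)) % d    ∎
    where
    open ≡-Reasoning
    open +-*-Solver

  fibPair : ℕ → ℕ × ℕ
  fibPair n = fib n % d , fib (suc n) % d

  fibPair-deterministic : Deterministic fibPair
  fibPair-deterministic m n eq with ,-injective eq
  ... | eq₀ , eq₁ = cong₂ _,_ eq₁ (%-cong-+ {a = fib (suc m)} {fib (suc n)} {fib m} {fib n} eq₁ eq₀)

  fibPair-reversible : Reversible fibPair
  fibPair-reversible m n eq with ,-injective eq
  ... | eq₁ , eq₂ = cong₂ _,_ eq₀ eq₁
    where
    eq₀ : fib m % d ≡ fib n % d
    eq₀ = begin
      fib m % d                                ≡⟨ fib-%-backward m ⟩
      (fib (2 + m) + d-1 * fib (1 + m)) % d    ≡⟨ %-cong-+ {a = fib (2 + m)} {fib (2 + n)} eq₂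
                                                    (%-cong-*ˡ d-1 {fib (1 + m)} {fib (1 + n)} eq₁) ⟩
      (fib (2 + n) + d-1 * fib (1 + n)) % d    ≡⟨ fib-%-backward n ⟨
      fib n % d                                ∎
      where open ≡-Reasoning

  fibPair-from-residues : ∀ {i j} →
                          (fib i mod d , fib (suc i) mod d) ≡ (fib j mod d , fib (suc j) mod d) →
                          fibPair i ≡ fibPair j
  fibPair-from-residues {i} {j} eq with ,-injective eq
  ... | eq₀ , eq₁ = cong₂ _,_ (mod≡⇒%≡ (fib i) (fib j) eq₀) (mod≡⇒%≡ (fib (suc i)) (fib (suc j)) eq₁)

  -- Opaque: unfolding the pigeonhole witness during later type checking is prohibitively slow.
  opaque
    fib-%-periodic : ∃ λ q → ∀ t n → fib (n + t * suc q) % d ≡ fib n % d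
    fib-%-periodic with sequence-repeats (λ n → fib n mod d , fib (suc n) mod d)
    ... | i , j , i<j , eq
      with reversible-repeat⇒return fibPair fibPair-reversible i<j (fibPair-from-residues {i} {j} eq)
    ...   | q , ret = q , λ t n →
      cong proj₁ (deterministic-return⇒periodic fibPair fibPair-deterministic ret t n)

-- K is a large multiple of a period of the Fibonacci sequence mod d.
aWeight-0-1-1-beyond : ∀ {d} → 2 ≤ d → ∀ N →
                       ∃ λ K → N < K × aWeight d K ≡ 0 × aWeight d (1 + K) ≡ 1 × aWeight d (2 + K) ≡ 1
aWeight-0-1-1-beyond {suc (suc d-2)} (s≤s (s≤s z≤n)) N with FibonacciMod.fib-%-periodic (suc d-2)
... | q , periodic = suc N * suc q , m≤m*n (suc N) (suc q)
                   , periodic (suc N) 0 , periodic (suc N) 1 , periodic (suc N) 2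

module Lacunary {c ℓ} (R : CommutativeRing c ℓ) where

  open CommutativeRing R
    using (Carrier; _≈_; 0#; 1#; setoid; reflexive; zeroˡ; zeroʳ)
    renaming (_+_ to _⊕_; _*_ to _⊗_; refl to ≈-refl; trans to ≈-trans;
              +-cong to ⊕-cong; *-cong to ⊗-cong; +-identityˡ to ⊕-identityˡ;
              +-identityʳ to ⊕-identityʳ; *-identityʳ to ⊗-identityʳ)
  open import Relation.Binary.Reasoning.Setoid setoid

  Σ<-zero : ∀ n (f : ℕ → Carrier) → (∀ i → i < n → f i ≈ 0#) → Σ< R n f ≈ 0#
  Σ<-zero zero    f f≈0 = ≈-refl
  Σ<-zero (suc n) f f≈0 = ≈-trans (⊕-cong (Σ<-zero n f (λ i → f≈0 i ∘ m<n⇒m<1+n)) (f≈0 n (n<1+n n)))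
                                  (⊕-identityˡ 0#)

  Σ<-single : ∀ n (f : ℕ → Carrier) k → k < n → (∀ i → i < n → i ≢ k → f i ≈ 0#) → Σ< R n f ≈ f k
  Σ<-single (suc n) f k k<1+n f≈0 with k ≟ n
  ... | yes refl = ≈-trans (⊕-cong (Σ<-zero n f (λ i i<n → f≈0 i (m<n⇒m<1+n i<n) (<⇒≢ i<n))) ≈-refl)
                           (⊕-identityˡ (f k))
  ... | no k≢n = ≈-trans (⊕-cong (Σ<-single n f k (≤∧≢⇒< (≤-pred k<1+n) k≢n) (λ i → f≈0 i ∘ m<n⇒m<1+n))
                                 (f≈0 n (n<1+n n) (k≢n ∘ sym)))
                         (⊕-identityʳ (f k))

  coeff-≥length : ∀ P {j} → length P ≤ j → coeff R P j ≡ 0#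
  coeff-≥length []                _       = refl
  coeff-≥length (a ∷ P) {suc j} (s≤s P≤j) = coeff-≥length P P≤j

  zero-coeffs⇒¬NonZeroPoly : ∀ P → (∀ k → coeff R P k ≈ 0#) → ¬ NonZeroPoly R P
  zero-coeffs⇒¬NonZeroPoly (a ∷ P) P≈0 (here a≉0)  = a≉0 (P≈0 0)
  zero-coeffs⇒¬NonZeroPoly (a ∷ P) P≈0 (there P≉0) = zero-coeffs⇒¬NonZeroPoly P (P≈0 ∘ suc) P≉0

  mulCoeff-zeroˡ : ∀ P f m → (∀ k → coeff R P k ≈ 0#) → mulCoeff R P f m ≈ 0#
  mulCoeff-zeroˡ P f m P≈0 = Σ<-zero (suc m) _ (λ k _ → ≈-trans (⊗-cong (P≈0 k) ≈-refl) (zeroˡ _))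

  -- The summands of lacCoeff are a local function of Defs; the types of lacSummand-nonPower
  -- and lacSummand-power leave them to unification with their uses in this block.
  mutual
    lacCoeff-nonPower : ∀ d s m → (∀ n → d ^ (n + s) ≢ m) → lacCoeff R d s m ≈ 0#
    lacCoeff-nonPower d s m ≢m = Σ<-zero (suc m) _ (λ n _ → lacSummand-nonPower d s m n (≢m n))

    lacCoeff-power : ∀ {d} → 2 ≤ d → ∀ s n {m} → d ^ (n + s) ≡ m → lacCoeff R d s m ≈ ι R (aWeight d n)
    lacCoeff-power {d} 2≤d s n {m} ≡m =
      ≈-trans (Σ<-single (suc m) _ n n<1+m
                (λ i _ i≢n → lacSummand-nonPower d s m i (i≢n ∘ exponent-injective)))
              (lacSummand-power d s m n ≡m)
      where
      n<1+m : n < suc m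
      n<1+m = s≤s (subst (n ≤_) ≡m (≤-trans (m≤m+n n s) (<⇒≤ (n<m^n 2≤d (n + s)))))
      exponent-injective : ∀ {i} → d ^ (i + s) ≡ m → i ≡ n
      exponent-injective {i} ≡m′ = +-cancelʳ-≡ s i n (^-injectiveʳ 2≤d (trans ≡m′ (sym ≡m)))

    lacSummand-nonPower : ∀ d s m n → d ^ (n + s) ≢ m → _ ≈ 0#
    lacSummand-nonPower d s m n ≢m with d ^ (n + s) ≟ m
    ... | yes ≡m = contradiction ≡m ≢m
    ... | no _   = ≈-refl

    lacSummand-power : ∀ d s m n → d ^ (n + s) ≡ m → _ ≈ ι R (aWeight d n)
    lacSummand-power d s m n ≡m with d ^ (n + s) ≟ m
    ... | yes _ = ≈-refl
    ... | no ≢m = contradiction ≡m ≢m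

  mulCoeff-lacCoeff-gap : ∀ {d} → 2 ≤ d → ∀ s P M k → length P ≤ d ^ M → k < d ^ M →
                          mulCoeff R P (lacCoeff R d s) (d ^ suc M + k)
                            ≈ coeff R P k ⊗ lacCoeff R d s (d ^ suc M)
  mulCoeff-lacCoeff-gap {d} 2≤d s P M k P≤d^M k<d^M =
    ≈-trans (Σ<-single (suc m) _ k (s≤s (m≤n+m k (d ^ suc M))) off-k)
            (⊗-cong ≈-refl (reflexive (cong (lacCoeff R d s) (m+n∸n≡m (d ^ suc M) k))))
    where
    m : ℕ
    m = d ^ suc M + k
    off-k : ∀ j → j < suc m → j ≢ k → coeff R P j ⊗ lacCoeff R d s (m ∸ j) ≈ 0#
    off-k j j<1+m j≢k with j <? length P
    ... | no  j≮P = ≈-trans (⊗-cong (reflexive (coeff-≥length P (≮⇒≥ j≮P))) ≈-refl) (zeroˡ _)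
    ... | yes j<P = ≈-trans (⊗-cong ≈-refl (lacCoeff-nonPower d s (m ∸ j) not-power)) (zeroʳ _)
      where
      not-power : ∀ n → d ^ (n + s) ≢ m ∸ j
      not-power n ≡m∸j = j≢k (pow-gap 2≤d {n + s} {M} (<-≤-trans j<P P≤d^M) k<d^M
                                (trans (cong (_+ j) ≡m∸j) (m∸n+n≡m (≤-pred j<1+m))))

  IsRelation : ℕ → List Carrier → List Carrier → List Carrier → Set ℓ
  IsRelation d P₀ P₁ P₂ = ∀ m →
    (coeff R P₀ m ⊕ mulCoeff R P₁ (lacCoeff R d 0) m ⊕ mulCoeff R P₂ (lacCoeff R d 1) m) ≈ 0#

  relation-at-gap : ∀ {d} → 2 ≤ d → ∀ {P₀ P₁ P₂} → IsRelation d P₀ P₁ P₂ → ∀ M k →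
                    length P₀ ≤ d ^ M → length P₁ ≤ d ^ M → length P₂ ≤ d ^ M → k < d ^ M →
                    coeff R P₁ k ⊗ ι R (aWeight d (suc M)) ⊕ coeff R P₂ k ⊗ ι R (aWeight d M) ≈ 0#
  relation-at-gap {d@(suc _)} 2≤d {P₀} {P₁} {P₂} rel M k P₀≤ P₁≤ P₂≤ k< = begin
    coeff R P₁ k ⊗ ι R (aWeight d (suc M)) ⊕ coeff R P₂ k ⊗ ι R (aWeight d M)
      ≈⟨ ⊕-cong (⊕-identityˡ _) ≈-refl ⟨
    0# ⊕ coeff R P₁ k ⊗ ι R (aWeight d (suc M)) ⊕ coeff R P₂ k ⊗ ι R (aWeight d M)
      ≈⟨ ⊕-cong (⊕-cong P₀-vanishes P₁-term) P₂-term ⟨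
    coeff R P₀ m ⊕ mulCoeff R P₁ (lacCoeff R d 0) m ⊕ mulCoeff R P₂ (lacCoeff R d 1) m
      ≈⟨ rel m ⟩
    0# ∎
    where
    m : ℕ
    m = d ^ suc M + k
    P₀-vanishes : coeff R P₀ m ≈ 0#
    P₀-vanishes =
      reflexive (coeff-≥length P₀ (≤-trans P₀≤ (≤-trans (^-monoʳ-≤ d (n≤1+n M)) (m≤m+n _ k))))
    P₁-term : mulCoeff R P₁ (lacCoeff R d 0) m ≈ coeff R P₁ k ⊗ ι R (aWeight d (suc M))
    P₁-term = ≈-trans (mulCoeff-lacCoeff-gap 2≤d 0 P₁ M k P₁≤ k<)
                      (⊗-cong ≈-refl (lacCoeff-power 2≤d 0 (suc M) (cong (d ^_) (+-identityʳ (suc M)))))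
    P₂-term : mulCoeff R P₂ (lacCoeff R d 1) m ≈ coeff R P₂ k ⊗ ι R (aWeight d M)
    P₂-term = ≈-trans (mulCoeff-lacCoeff-gap 2≤d 1 P₂ M k P₂≤ k<)
                      (⊗-cong ≈-refl (lacCoeff-power 2≤d 1 M (cong (d ^_) (+-comm M 1))))

  x⊗ι1≈x : ∀ x → x ⊗ ι R 1 ≈ x
  x⊗ι1≈x x = ≈-trans (⊗-cong ≈-refl (⊕-identityʳ 1#)) (⊗-identityʳ x)

  relation⇒P₁P₂-vanish : ∀ {d} → 2 ≤ d → ∀ {P₀ P₁ P₂} → IsRelation d P₀ P₁ P₂ → ∀ k K →
                         k + (length P₀ + length P₁ + length P₂) < K →
                         aWeight d K ≡ 0 → aWeight d (1 + K) ≡ 1 → aWeight d (2 + K) ≡ 1 →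
                         coeff R P₁ k ≈ 0# × coeff R P₂ k ≈ 0#
  relation⇒P₁P₂-vanish {d} 2≤d {P₀} {P₁} {P₂} rel k K N<K w₀ w₁ w₂ = P₁k≈0 , P₂k≈0
    where
    weighted : ℕ → ℕ → Carrier
    weighted a b = coeff R P₁ k ⊗ ι R a ⊕ coeff R P₂ k ⊗ ι R b

    gap : ∀ M → K ≤ M → weighted (aWeight d (suc M)) (aWeight d M) ≈ 0#
    gap M K≤M = relation-at-gap 2≤d {P₀} {P₁} {P₂} rel M k
                  (m+n≤o⇒m≤o _ P₀₁≤) (m+n≤o⇒n≤o _ P₀₁≤) (m+n≤o⇒n≤o _ P₀₁₂≤) (m+n≤o⇒m≤o (suc k) N<d^M)
      where
      N<d^M : k + (length P₀ + length P₁ + length P₂) < d ^ M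
      N<d^M = <-≤-trans N<K (≤-trans K≤M (<⇒≤ (n<m^n 2≤d M)))
      P₀₁₂≤ : length P₀ + length P₁ + length P₂ ≤ d ^ M
      P₀₁₂≤ = m+n≤o⇒n≤o (suc k) N<d^M
      P₀₁≤ : length P₀ + length P₁ ≤ d ^ M
      P₀₁≤ = m+n≤o⇒m≤o _ P₀₁₂≤

    P₁k≈0 : coeff R P₁ k ≈ 0#
    P₁k≈0 = begin
      coeff R P₁ k                                   ≈⟨ x⊗ι1≈x _ ⟨
      coeff R P₁ k ⊗ ι R 1                           ≈⟨ ⊕-identityʳ _ ⟨
      coeff R P₁ k ⊗ ι R 1 ⊕ 0#                      ≈⟨ ⊕-cong ≈-refl (zeroʳ _) ⟨
      weighted 1 0                                   ≡⟨ cong₂ weighted w₁ w₀ ⟨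
      weighted (aWeight d (suc K)) (aWeight d K)     ≈⟨ gap K ≤-refl ⟩
      0#                                             ∎

    P₂k≈0 : coeff R P₂ k ≈ 0#
    P₂k≈0 = begin
      coeff R P₂ k                                   ≈⟨ ⊕-identityˡ _ ⟨
      0# ⊕ coeff R P₂ k                              ≈⟨ ⊕-cong P₁k≈0 ≈-refl ⟨
      coeff R P₁ k ⊕ coeff R P₂ k                    ≈⟨ ⊕-cong (x⊗ι1≈x _) (x⊗ι1≈x _) ⟨
      weighted 1 1                                   ≡⟨ cong₂ weighted w₂ w₁ ⟨
      weighted (aWeight d (2 + K)) (aWeight d (1 + K)) ≈⟨ gap (suc K) (n≤1+n K) ⟩
      0#                                             ∎

  no-nontrivial-relation : ∀ {d} → 2 ≤ d → ∀ {P₀ P₁ P₂} → IsRelation d P₀ P₁ P₂ →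
                           ¬ (NonZeroPoly R P₀ ⊎ NonZeroPoly R P₁ ⊎ NonZeroPoly R P₂)
  no-nontrivial-relation {d} 2≤d {P₀} {P₁} {P₂} rel =
    [ zero-coeffs⇒¬NonZeroPoly P₀ P₀-vanishes
    , [ zero-coeffs⇒¬NonZeroPoly P₁ P₁-vanishes , zero-coeffs⇒¬NonZeroPoly P₂ P₂-vanishes ] ]
    where
    P₁P₂-vanish : ∀ k → coeff R P₁ k ≈ 0# × coeff R P₂ k ≈ 0#
    P₁P₂-vanish k with aWeight-0-1-1-beyond 2≤d (k + (length P₀ + length P₁ + length P₂))
    ... | K , N<K , w₀ , w₁ , w₂ = relation⇒P₁P₂-vanish 2≤d {P₀} {P₁} {P₂} rel k K N<K w₀ w₁ w₂
    P₁-vanishes : ∀ k → coeff R P₁ k ≈ 0#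
    P₁-vanishes = proj₁ ∘ P₁P₂-vanish
    P₂-vanishes : ∀ k → coeff R P₂ k ≈ 0#
    P₂-vanishes = proj₂ ∘ P₁P₂-vanish
    P₀-vanishes : ∀ m → coeff R P₀ m ≈ 0#
    P₀-vanishes m = begin
      coeff R P₀ m                  ≈⟨ ≈-trans (⊕-identityʳ _) (⊕-identityʳ _) ⟨
      coeff R P₀ m ⊕ 0# ⊕ 0#        ≈⟨ ⊕-cong (⊕-cong ≈-refl (mulCoeff-zeroˡ P₁ (lacCoeff R d 0) m P₁-vanishes))
                                              (mulCoeff-zeroˡ P₂ (lacCoeff R d 1) m P₂-vanishes) ⟨
      coeff R P₀ m ⊕ mulCoeff R P₁ (lacCoeff R d 0) m ⊕ mulCoeff R P₂ (lacCoeff R d 1) m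
                                    ≈⟨ rel m ⟩
      0#                            ∎

lemma6p2 : ∀ {c ℓ : Level} (p : ℕ) → Prime p → (d : ℕ) → 2 ≤ d → ¬ (p ∣ d) →
    (L : CommutativeRing c ℓ) → IsField L → HasChar L p → AlgClosed L →
    (T : CommutativeRing.Carrier L) → Transcendental L p T →
    (∀ x → AlgebraicOver L p T x) →
    ¬ LinDep-1-a-ad L d
lemma6p2 _ _ _ 2≤d _ L _ _ _ _ _ _ (P₀ , P₁ , P₂ , nonzero , relation) =
  Lacunary.no-nontrivial-relation L 2≤d relation nonzero
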